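{- Let $m\ge0$ and let $(h(i))_{i\ge1}$ be a strictly increasing sequence of positive integers. Define $f:\Sigma_2^m\times\Sigma_2^m\to\mathbb{N}$ by $f(x,y)=\sum_{i=1}^m(x_i+y_i)h(i)+2$ for $x=x_m\cdots x_1$, $y=y_m\cdots y_1$, let $\sim$ be the equivalence relation $(x,y)\sim(x',y')\iff f(x,y)=f(x',y')$, and let $\widetilde{\Sigma}^m=(\Sigma_2^m\times\Sigma_2^m)/\sim$ (so $f$ induces an injection $\widetilde\Sigma^m\to\mathbb N$). Let $\varphi_m:\widetilde\Sigma^m\to\widetilde\Sigma^m$ be the well-defined map $\varphi_m(u,v)=(\bar u,\bar v)$, where $\bar u$ is obtained from $u$ by replacing each letter $\epsilon$ by $1-\epsilon$. Put $M=\sum_{i=1}^m h(i)+1$ and \[ L_m=\{(u,v)\in\widetilde\Sigma^m: f(u,v)\le M\},\qquad R_m=\{(u,v)\in\widetilde\Sigma^m: M+1<f(u,v)\le 2M\}. \] Then the restriction of $\varphi_m$ to $L_m$ is a bijection from $L_m$ onto $R_m$.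
   Context: $\Sigma_2=\{0,1\}$ and $\Sigma_2^m$ is the set of words of length $m$ over $\Sigma_2$, written $x=x_mx_{m-1}\cdots x_1$. -}

module Defs where

open import Data.Bool using (Bool; true; false; not)
open import Data.Nat using (ℕ; zero; suc; _+_; _*_; _≤_; _<_)
open import Data.Fin using (Fin; toℕ) renaming (zero to fzero; suc to fsuc)
open import Data.Product using (_×_; _,_; proj₁; proj₂)
open import Relation.Binary.PropositionalEquality using (_≡_)

bit : Bool → ℕ
bit false = 0
bit true  = 1

-- A word x = x_m ⋯ x_1 in Σ₂^m: the function sends i : Fin m to the letter x_{i+1}.
Word : ℕ → Set
Word m = Fin m → Bool

sumFin : (n : ℕ) → (Fin n → ℕ) → ℕ
sumFin zero    g = 0
sumFin (suc n) g = g fzero + sumFin n (λ i → g (fsuc i))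

Pair : ℕ → Set
Pair m = Word m × Word m

f : (ℕ → ℕ) → (m : ℕ) → Pair m → ℕ
f h m (x , y) = sumFin m (λ i → (bit (x i) + bit (y i)) * h (suc (toℕ i))) + 2

-- the equivalence (x,y) ∼ (x',y') ⇔ f(x,y) = f(x',y'); the quotient Σ̃^m is
-- represented as the setoid (Pair m, ∼), i.e. the statement uses f p ≡ f q.

φ : {m : ℕ} → Pair m → Pair m
φ (u , v) = (λ i → not (u i)) , (λ i → not (v i))

M : (ℕ → ℕ) → ℕ → ℕ
M h m = sumFin m (λ i → h (suc (toℕ i))) + 1

InL : (h : ℕ → ℕ) → (m : ℕ) → Pair m → Set
InL h m p = f h m p ≤ M h m

InR : (h : ℕ → ℕ) → (m : ℕ) → Pair m → Set
InR h m p = (suc (M h m) < f h m p) × (f h m p ≤ 2 * M h m)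

{-# OPTIONS --safe #-}
-- Complementing both words sends every letter sum bit xᵢ + bit yᵢ to 2 − (bit xᵢ + bit yᵢ),
-- so f(u,v) + f(ū,v̄) = 2M + 2 for every pair. Hence φ is the reflection a ↦ 2M + 2 − a on the
-- values of f: it respects ∼, is injective modulo ∼, is an involution, and since f ≥ 2 it swaps
-- the ranges [2, M] and [M + 2, 2M].
module Submission where

open import Defs
open import Data.Bool using (Bool; true; false; not)
open import Data.Bool.Properties using (not-involutive)
open import Data.Fin using (Fin; toℕ) renaming (zero to fzero; suc to fsuc)
open import Data.Nat using (ℕ; zero; suc; _+_; _*_; _≤_; _<_)
open import Data.Nat.Properties
open import Data.Product using (_×_; _,_; Σ)
open import Relation.Binary.PropositionalEquality
open import Data.Nat.Tactic.RingSolver using (solve-∀)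
open import Algebra.Properties.CommutativeSemigroup +-commutativeSemigroup using (interchange)

sumFin-cong : ∀ n {a b : Fin n → ℕ} → (∀ i → a i ≡ b i) → sumFin n a ≡ sumFin n b
sumFin-cong zero    a≗b = refl
sumFin-cong (suc n) a≗b = cong₂ _+_ (a≗b fzero) (sumFin-cong n (λ i → a≗b (fsuc i)))

sumFin-+ : ∀ n (a b : Fin n → ℕ) → sumFin n a + sumFin n b ≡ sumFin n (λ i → a i + b i)
sumFin-+ zero    a b = refl
sumFin-+ (suc n) a b = trans (interchange (a fzero) _ (b fzero) _)
  (cong (a fzero + b fzero +_) (sumFin-+ n (λ i → a (fsuc i)) (λ i → b (fsuc i))))

sumFin-*ˡ : ∀ n c (a : Fin n → ℕ) → sumFin n (λ i → c * a i) ≡ c * sumFin n a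
sumFin-*ˡ zero    c a = sym (*-zeroʳ c)
sumFin-*ˡ (suc n) c a = trans (cong (c * a fzero +_) (sumFin-*ˡ n c (λ i → a (fsuc i))))
  (sym (*-distribˡ-+ c (a fzero) _))

bit-+-bit-not : ∀ b → bit b + bit (not b) ≡ 1
bit-+-bit-not false = refl
bit-+-bit-not true  = refl

letterSum : Bool → Bool → ℕ
letterSum x y = bit x + bit y

letterSum-+-letterSum-not : ∀ x y → letterSum x y + letterSum (not x) (not y) ≡ 2
letterSum-+-letterSum-not x y = begin
  bit x + bit y + (bit (not x) + bit (not y))   ≡⟨ interchange (bit x) (bit y) _ _ ⟩
  bit x + bit (not x) + (bit y + bit (not y))   ≡⟨ cong₂ _+_ (bit-+-bit-not x) (bit-+-bit-not y) ⟩
  2                                             ∎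
  where open ≡-Reasoning

sumFin-letterSum-complement : ∀ n (k : Fin n → ℕ) (x y : Fin n → Bool) →
  sumFin n (λ i → letterSum (x i) (y i) * k i) + sumFin n (λ i → letterSum (not (x i)) (not (y i)) * k i)
    ≡ 2 * sumFin n k
sumFin-letterSum-complement n k x y = begin
  sumFin n (λ i → letterSum (x i) (y i) * k i) + sumFin n (λ i → letterSum (not (x i)) (not (y i)) * k i)
    ≡⟨ sumFin-+ n _ _ ⟩
  sumFin n (λ i → letterSum (x i) (y i) * k i + letterSum (not (x i)) (not (y i)) * k i)
    ≡⟨ sumFin-cong n pointwise ⟩
  sumFin n (λ i → 2 * k i)
    ≡⟨ sumFin-*ˡ n 2 k ⟩
  2 * sumFin n k ∎
  where
  open ≡-Reasoning
  pointwise : ∀ i → letterSum (x i) (y i) * k i + letterSum (not (x i)) (not (y i)) * k i ≡ 2 * k i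
  pointwise i = trans (sym (*-distribʳ-+ (k i) (letterSum (x i) (y i)) (letterSum (not (x i)) (not (y i))))) (cong (_* k i) (letterSum-+-letterSum-not (x i) (y i)))

f-+-f-φ : ∀ h m (p : Pair m) → f h m p + f h m (φ p) ≡ 2 * M h m + 2
f-+-f-φ h m (x , y) = begin
  s + 2 + (s̄ + 2)    ≡⟨ interchange s 2 s̄ 2 ⟩
  s + s̄ + 4          ≡⟨ cong (_+ 4) (sumFin-letterSum-complement m k x y) ⟩
  2 * S + 4          ≡⟨ regroup S ⟩
  2 * (S + 1) + 2    ∎
  where
  open ≡-Reasoning
  k : Fin m → ℕ
  k i = h (suc (toℕ i))
  s s̄ S : ℕ
  s = sumFin m (λ i → letterSum (x i) (y i) * k i)
  s̄ = sumFin m (λ i → letterSum (not (x i)) (not (y i)) * k i)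
  S = sumFin m k
  regroup : ∀ S → 2 * S + 4 ≡ 2 * (S + 1) + 2
  regroup = solve-∀

f-φ-φ : ∀ h m (p : Pair m) → f h m (φ (φ p)) ≡ f h m p
f-φ-φ h m (x , y) = cong (_+ 2) (sumFin-cong m λ i →
  cong₂ (λ a b → letterSum a b * h (suc (toℕ i))) (not-involutive (x i)) (not-involutive (y i)))

2≤f : ∀ h m (p : Pair m) → 2 ≤ f h m p
2≤f h m (x , y) = m≤n+m 2 _

complement-≡ : ∀ {a b a′ b′ c} → a + b ≡ c → a′ + b′ ≡ c → a ≡ a′ → b ≡ b′
complement-≡ {a} {b} {b′ = b′} e e′ refl = +-cancelˡ-≡ a b b′ (trans e (sym e′))

complement-≤ : ∀ {a b c d} → a + b ≡ c + d → a ≤ c → d ≤ b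
complement-≤ {a} {b} {c} {d} e a≤c = +-cancelˡ-≤ c d b (subst (_≤ c + b) e (+-monoˡ-≤ b a≤c))

complement-≥ : ∀ {a b c d} → a + b ≡ c + d → c ≤ a → b ≤ d
complement-≥ {a} {b} {c} {d} e c≤a = +-cancelˡ-≤ c b d (subst (c + b ≤_) e (+-monoˡ-≤ b c≤a))

mainTheorem4 : (h : ℕ → ℕ) → (∀ i → 1 ≤ i → 0 < h i) → (∀ i j → 1 ≤ i → i < j → h i < h j) → (m : ℕ) →
    -- φ_m is well defined on the quotient
    (∀ (p q : Pair m) → f h m p ≡ f h m q → f h m (φ p) ≡ f h m (φ q))
    -- φ_m maps L_m into R_m
    × (∀ (p : Pair m) → InL h m p → InR h m (φ p))
    -- injective on L_m (modulo ∼)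
    × (∀ (p q : Pair m) → InL h m p → InL h m q → f h m (φ p) ≡ f h m (φ q) → f h m p ≡ f h m q)
    -- surjective onto R_m (modulo ∼)
    × (∀ (q : Pair m) → InR h m q → Σ (Pair m) (λ p → InL h m p × f h m (φ p) ≡ f h m q))
mainTheorem4 h _ _ m = respects , mapsInto , injective , surjective
  where
  pairs : ∀ p → f h m p + f h m (φ p) ≡ 2 * M h m + 2
  pairs = f-+-f-φ h m
  pairs′ : ∀ p → f h m (φ p) + f h m p ≡ 2 * M h m + 2
  pairs′ p = trans (+-comm (f h m (φ p)) (f h m p)) (pairs p)
  split : ∀ n → 2 * n + 2 ≡ n + suc (suc n)
  split = solve-∀
  respects : ∀ p q → f h m p ≡ f h m q → f h m (φ p) ≡ f h m (φ q)
  respects p q = complement-≡ (pairs p) (pairs q)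
  mapsInto : ∀ p → InL h m p → InR h m (φ p)
  mapsInto p fp≤M = complement-≤ (trans (pairs p) (split (M h m))) fp≤M
                  , complement-≥ (trans (pairs p) (+-comm _ 2)) (2≤f h m p)
  injective : ∀ p q → InL h m p → InL h m q → f h m (φ p) ≡ f h m (φ q) → f h m p ≡ f h m q
  injective p q _ _ = complement-≡ (pairs′ p) (pairs′ q)
  surjective : ∀ q → InR h m q → Σ (Pair m) (λ p → InL h m p × f h m (φ p) ≡ f h m q)
  surjective q (M+1<fq , _) =
    φ q , complement-≥ (trans (pairs q) (trans (split (M h m)) (+-comm (M h m) (suc (suc (M h m)))))) M+1<fq , f-φ-φ h m q
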